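{- Let $\mathcal{F}=\langle S,R\rangle$ be a frame and $\mathcal{F}^m=\langle S,R^m\rangle$ its mirror reduction. Then for every formula $\varphi\in\mathcal{L}(\nabla,\bullet)$, $\mathcal{F}^m\vDash\varphi$ if and only if $\mathcal{F}\vDash\varphi$.
   Context: Fix a nonempty set $\mathbf{P}$ of propositional variables. $\mathcal{L}(\nabla,\bullet)$: $\varphi::=p\mid\neg\varphi\mid\varphi\land\varphi\mid\nabla\varphi\mid\bullet\varphi$ ($p\in\mathbf{P}$). A frame is $\mathcal{F}=\langle S,R\rangle$ with $S$ nonempty, $R\subseteq S\times S$; a model on it adds $V:\mathbf{P}\to\mathcal{P}(S)$. Truth: $\mathcal{M},s\vDash p$ iff $s\in V(p)$; Booleans as usual; $\mathcal{M},s\vDash\nabla\varphi$ iff there are $t,u$ with $sRt$, $sRu$, $\mathcal{M},t\vDash\varphi$, $\mathcal{M},u\nvDash\varphi$; $\mathcal{M},s\vDash\bullet\varphi$ iff $\mathcal{M},s\vDash\varphi$ and some $t$ with $sRt$ has $\mathcal{M},t\nvDash\varphi$. $\mathcal{F}\vDash\varphi$ means $\varphi$ is true at every state of every model on $\mathcal{F}$. Writing $R(x)=\{y\mid xRy\}$, the mirror reduction of $\mathcal{F}$ is $\mathcal{F}^m=\langle S,R^m\rangle$ with $R^m=R\setminus\{(x,x)\mid R(x)=\{x\}\}$. -}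

module Defs where

open import Data.Product using (Σ; _×_; ∃-syntax)
open import Relation.Nullary using (¬_)
open import Relation.Binary.PropositionalEquality using (_≡_)

data Form (P : Set) : Set where
  var  : P → Form P
  ¬'_  : Form P → Form P
  _∧'_ : Form P → Form P → Form P
  ∇_   : Form P → Form P
  •_   : Form P → Form P

record Frame : Set₁ where
  field
    S    : Set
    R    : S → S → Set
    inhabitant : S

open Frame public

Valuation : Set → Set → Set₁
Valuation P S = P → S → Set

_,_,_⊨_ : {P : Set} (F : Frame) → Valuation P (S F) → S F → Form P → Set
F , V , s ⊨ var p   = V p s
F , V , s ⊨ (¬' φ)  = ¬ (F , V , s ⊨ φ)
F , V , s ⊨ (φ ∧' ψ) = (F , V , s ⊨ φ) × (F , V , s ⊨ ψ)
F , V , s ⊨ (∇ φ)   = ∃[ t ] ∃[ u ] (R F s t × R F s u × (F , V , t ⊨ φ) × ¬ (F , V , u ⊨ φ))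
F , V , s ⊨ (• φ)   = (F , V , s ⊨ φ) × (∃[ t ] (R F s t × ¬ (F , V , t ⊨ φ)))

_⊫_ : {P : Set} → Frame → Form P → Set₁
_⊫_ {P} F φ = (V : Valuation P (S F)) (s : S F) → F , V , s ⊨ φ

IsSingletonSelf : (F : Frame) → S F → Set
IsSingletonSelf F x = R F x x × ((y : S F) → R F x y → y ≡ x)

mirror : Frame → Frame
mirror F = record
  { S = S F
  ; R = λ x y → R F x y × ¬ (x ≡ y × IsSingletonSelf F x)
  ; inhabitant = inhabitant F
  }

-- The truth conditions of ∇ and • only ever use an edge from s to a state whose
-- truth value differs from that of s or of another successor of s. An edge
-- removed by the mirror reduction is a loop at a state with no other
-- successor, so it never serves as such a witness; hence F and F^m agree on
-- truth at every state under every valuation.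
module Submission where

open import Defs
open import Function.Bundles using (_⇔_; mk⇔; Equivalence)
open import Data.Product using (_,_; proj₁)
open import Relation.Nullary using (¬_)
open import Relation.Binary.PropositionalEquality using (_≢_; ≢-sym; sym; trans; subst)

module _ (F : Frame) where

  mirror-⊆ : ∀ {x y} → R (mirror F) x y → R F x y
  mirror-⊆ = proj₁

  mirror-keeps-non-loop : ∀ {x y} → R F x y → x ≢ y → R (mirror F) x y
  mirror-keeps-non-loop xRy x≢y = xRy , λ (x≡y , _) → x≢y x≡y

  mirror-keeps-branching : ∀ {x y z} → R F x y → R F x z → z ≢ y → R (mirror F) x y
  mirror-keeps-branching xRy xRz z≢y =
    xRy , λ (x≡y , _ , only-x) → z≢y (trans (only-x _ xRz) x≡y)

module _ {P : Set} (F : Frame) (V : Valuation P (S F)) where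

  ⊨-separates : ∀ {t u} (φ : Form P) → F , V , t ⊨ φ → ¬ (F , V , u ⊨ φ) → u ≢ t
  ⊨-separates φ t⊨φ u⊭φ u≡t = u⊭φ (subst (λ x → F , V , x ⊨ φ) (sym u≡t) t⊨φ)

  mirror-⊨→⊨ : ∀ (φ : Form P) s → mirror F , V , s ⊨ φ → F , V , s ⊨ φ
  ⊨→mirror-⊨ : ∀ (φ : Form P) s → F , V , s ⊨ φ → mirror F , V , s ⊨ φ

  mirror-⊨→⊨ (var p)  s s⊨p = s⊨p
  mirror-⊨→⊨ (¬' φ)   s s⊭φ = λ s⊨φ → s⊭φ (⊨→mirror-⊨ φ s s⊨φ)
  mirror-⊨→⊨ (φ ∧' ψ) s (s⊨φ , s⊨ψ) = mirror-⊨→⊨ φ s s⊨φ , mirror-⊨→⊨ ψ s s⊨ψ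
  mirror-⊨→⊨ (∇ φ)    s (t , u , sRt , sRu , t⊨φ , u⊭φ) =
    t , u , mirror-⊆ F sRt , mirror-⊆ F sRu , mirror-⊨→⊨ φ t t⊨φ ,
    λ u⊨φ → u⊭φ (⊨→mirror-⊨ φ u u⊨φ)
  mirror-⊨→⊨ (• φ)    s (s⊨φ , t , sRt , t⊭φ) =
    mirror-⊨→⊨ φ s s⊨φ , t , mirror-⊆ F sRt , λ t⊨φ → t⊭φ (⊨→mirror-⊨ φ t t⊨φ)

  ⊨→mirror-⊨ (var p)  s s⊨p = s⊨p
  ⊨→mirror-⊨ (¬' φ)   s s⊭φ = λ s⊨φ → s⊭φ (mirror-⊨→⊨ φ s s⊨φ)
  ⊨→mirror-⊨ (φ ∧' ψ) s (s⊨φ , s⊨ψ) = ⊨→mirror-⊨ φ s s⊨φ , ⊨→mirror-⊨ ψ s s⊨ψ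
  ⊨→mirror-⊨ (∇ φ)    s (t , u , sRt , sRu , t⊨φ , u⊭φ) =
    t , u ,
    mirror-keeps-branching F sRt sRu (⊨-separates φ t⊨φ u⊭φ) ,
    mirror-keeps-branching F sRu sRt (≢-sym (⊨-separates φ t⊨φ u⊭φ)) ,
    ⊨→mirror-⊨ φ t t⊨φ , λ u⊨φ → u⊭φ (mirror-⊨→⊨ φ u u⊨φ)
  ⊨→mirror-⊨ (• φ)    s (s⊨φ , t , sRt , t⊭φ) =
    ⊨→mirror-⊨ φ s s⊨φ , t ,
    mirror-keeps-non-loop F sRt (≢-sym (⊨-separates φ s⊨φ t⊭φ)) ,
    λ t⊨φ → t⊭φ (mirror-⊨→⊨ φ t t⊨φ)

  mirror-⊨⇔⊨ : ∀ (φ : Form P) s → (mirror F , V , s ⊨ φ) ⇔ (F , V , s ⊨ φ)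
  mirror-⊨⇔⊨ φ s = mk⇔ (mirror-⊨→⊨ φ s) (⊨→mirror-⊨ φ s)

mainTheorem6 : (P : Set) → P → (F : Frame) → (φ : Form P) →
    ((mirror F) ⊫ φ) ⇔ (F ⊫ φ)
mainTheorem6 P _ F φ =
  mk⇔ (λ valid V s → Equivalence.to   (mirror-⊨⇔⊨ F V φ s) (valid V s))
      (λ valid V s → Equivalence.from (mirror-⊨⇔⊨ F V φ s) (valid V s))
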